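{- Let $G$ be a matroid on $[n]$ with no loops and no multiple points, and equip $[n]$ with its natural linear order. A subset $S\subseteq[n]$ is an nbb set of $G$ if and only if $S$ is an NBB set in the lattice $\bar{L}(G)$ with respect to this linear order on its atoms.
   Context: $\operatorname{cl}$ is matroid closure; $S$ is line-closed if $\operatorname{cl}(\{i,j\})\subseteq S$ for all $i,j\in S$; $\operatorname{lc}(S)$ is the intersection of line-closed sets containing $S$; $\bar{L}(G)$ is the lattice of line-closed sets ordered by inclusion, with join $X\vee Y=\operatorname{lc}(X\cup Y)$; its atoms are the singletons $\{i\}$, identified with $i\in[n]$. An increasing set $S=\{i_1<\dots<i_p\}$ is nbb if $i_k=\min\operatorname{lc}(\{i_k,\dots,i_p\})$ for each $k$. (Blass–Sagan) For a finite lattice $\bar L$ with a partial order $\preceq$ on its atoms, a set $T$ of atoms is bounded below if there is an atom $a$ with $a<\bigvee T$ and $a\prec t$ for all $t\in T$; a set $S$ of atoms is NBB if it contains no subset $T$ that is bounded below. -}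

module Defs where

open import Data.Nat using (ℕ)
open import Data.Fin using (Fin; _≤_; _<_)
open import Data.Fin.Subset using (Subset; _∈_; _∉_; _⊆_; _∪_; ⁅_⁆; ⊥)
open import Data.Product using (Σ; ∃; _×_; _,_)
open import Relation.Binary.PropositionalEquality using (_≡_)
open import Relation.Nullary using (¬_)
open import Level using (0ℓ; suc)

record Matroid (n : ℕ) : Set where
  field
    cl         : Subset n → Subset n
    extensive  : ∀ X → X ⊆ cl X
    monotone   : ∀ {X Y} → X ⊆ Y → cl X ⊆ cl Y
    idempotent : ∀ X → cl (cl X) ⊆ cl X
    exchange   : ∀ X x y → x ∉ cl X → x ∈ cl (X ∪ ⁅ y ⁆) → y ∈ cl (X ∪ ⁅ x ⁆)

module _ {n : ℕ} (G : Matroid n) where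
  open Matroid G

  NoLoops : Set
  NoLoops = ∀ x → x ∉ cl ⊥

  NoMultiplePoints : Set
  NoMultiplePoints = ∀ i j → j ∈ cl ⁅ i ⁆ → j ≡ i

  LineClosed : Subset n → Set
  LineClosed S = ∀ i j → i ∈ S → j ∈ S → cl (⁅ i ⁆ ∪ ⁅ j ⁆) ⊆ S

  _∈lc_ : Fin n → (Fin n → Set) → Set
  x ∈lc P = ∀ (T : Subset n) → LineClosed T → (∀ y → P y → y ∈ T) → x ∈ T

  IsMin : (Fin n → Set) → Fin n → Set
  IsMin P i = P i × (∀ j → P j → i ≤ j)

  nbb : Subset n → Set
  nbb S = ∀ i → i ∈ S → IsMin (λ x → x ∈lc (λ j → j ∈ S × i ≤ j)) i

  -- Join in the lattice L̄(G) of a set T of atoms: ⋁T = lc(⋃_{t∈T} {t}) = lc(T).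
  _∈⋁_ : Fin n → Subset n → Set
  x ∈⋁ T = x ∈lc (λ y → y ∈ T)

  -- a < ⋁T in L̄(G): {a} ⊆ ⋁T and {a} ≠ ⋁T (i.e. not ⋁T ⊆ {a})
  AtomBelowJoin : Fin n → Subset n → Set
  AtomBelowJoin a T = a ∈⋁ T × ¬ (∀ x → x ∈⋁ T → x ≡ a)

  BoundedBelow : Subset n → Set
  BoundedBelow T = ∃ λ a → AtomBelowJoin a T × (∀ t → t ∈ T → a < t)

  NBB : Subset n → Set
  NBB S = ∀ (T : Subset n) → T ⊆ S → ¬ BoundedBelow T

{-# OPTIONS --safe #-}
-- If T ⊆ S is bounded below by an atom a, then a lies in lc(T), so T ≠ ∅
-- (∅ is line-closed) and a lies in lc{j ∈ S | m ≤ j} for m = min T; nbb at m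
-- then forces m ≤ a < m.
-- Conversely, if some j < i lies in lc{k ∈ S | i ≤ k}, that set is bounded
-- below by j: its join also contains i ≠ j, so j lies strictly below it.
module Submission where

open import Defs
open import Data.Nat using (ℕ)
import Data.Nat.Properties as ℕ
open import Data.Fin using (Fin; _≤_; _<_)
open import Data.Fin.Properties using (≤-refl; _≤?_; <⇒≢; any?; _<?_)
open import Data.Fin.Induction using (<-wellFounded)
open import Data.Fin.Subset using (Subset; _∈_; ⊥; Nonempty)
open import Data.Fin.Subset.Properties using (_∈?_; ∉⊥; nonempty?)
open import Data.Vec using (tabulate)
open import Data.Vec.Properties using (lookup⇒[]=; []=⇒lookup; lookup∘tabulate)
open import Data.Bool.Properties using (T-≡)
open import Data.Product using (∃; _×_; _,_; proj₁; proj₂)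
open import Data.Empty using (⊥-elim)
open import Function using (_∘_)
open import Function.Bundles using (_⇔_; mk⇔; module Equivalence)
open import Induction.WellFounded using (Acc; acc)
open import Relation.Binary.PropositionalEquality using (sym; trans)
open import Relation.Nullary using (yes; no)
open import Relation.Nullary.Decidable using (_×-dec_; ⌊_⌋; toWitness; fromWitness)
open import Relation.Unary using (Pred; Decidable)
open import Level using (0ℓ)

module _ {n : ℕ} where

  Nonempty⇒∃-least : (T : Subset n) → Nonempty T → ∃ λ i → i ∈ T × (∀ {u} → u ∈ T → i ≤ u)
  Nonempty⇒∃-least T (t , t∈T) = descend t (<-wellFounded t) t∈T
    where
    descend : ∀ t → Acc _<_ t → t ∈ T → ∃ λ i → i ∈ T × (∀ {u} → u ∈ T → i ≤ u)
    descend t (acc below) t∈T with any? (λ u → (u ∈? T) ×-dec (u <? t))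
    ... | yes (u , u∈T , u<t) = descend u (below u<t) u∈T
    ... | no ∄u = t , t∈T , λ {u} u∈T → ℕ.≮⇒≥ (λ u<t → ∄u (u , u∈T , u<t))

  fromDecidable : {P : Pred (Fin n) 0ℓ} → Decidable P → Subset n
  fromDecidable P? = tabulate (⌊_⌋ ∘ P?)

  ∈-fromDecidable : {P : Pred (Fin n) 0ℓ} (P? : Decidable P) {k : Fin n} →
                    k ∈ fromDecidable P? ⇔ P k
  ∈-fromDecidable P? {k} = mk⇔
    (λ k∈ → toWitness (Equivalence.from T-≡ (trans (sym (lookup∘tabulate _ k)) ([]=⇒lookup k∈))))
    (λ Pk → lookup⇒[]= k _ (trans (lookup∘tabulate _ k) (Equivalence.to T-≡ (fromWitness Pk))))

  _≥_ : Subset n → Fin n → Subset n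
  S ≥ i = fromDecidable (λ k → (k ∈? S) ×-dec (i ≤? k))

  ∈-≥ : ∀ {S i k} → k ∈ S ≥ i ⇔ (k ∈ S × i ≤ k)
  ∈-≥ {S} {i} = ∈-fromDecidable (λ k → (k ∈? S) ×-dec (i ≤? k))

module _ {n : ℕ} (G : Matroid n) where

  lc-mono : ∀ {P Q : Fin n → Set} {x} → (∀ y → P y → Q y) → _∈lc_ G x P → _∈lc_ G x Q
  lc-mono P⊆Q x∈lcP U lcU Q⊆U = x∈lcP U lcU (λ y Py → Q⊆U y (P⊆Q y Py))

  lc-extensive : ∀ {P : Fin n → Set} {x} → P x → _∈lc_ G x P
  lc-extensive Px U _ P⊆U = P⊆U _ Px

  ⊥-lineClosed : LineClosed G ⊥
  ⊥-lineClosed i _ i∈⊥ _ = ⊥-elim (∉⊥ i∈⊥)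

  ∈⋁⇒Nonempty : ∀ {x T} → _∈⋁_ G x T → Nonempty T
  ∈⋁⇒Nonempty {T = T} x∈⋁T with nonempty? T
  ... | yes T≠∅ = T≠∅
  ... | no T=∅ = ⊥-elim (∉⊥ (x∈⋁T ⊥ ⊥-lineClosed (λ y y∈T → ⊥-elim (T=∅ (y , y∈T)))))

  boundedBelow : ∀ {T a i} → _∈⋁_ G a T → _∈⋁_ G i T → a < i →
                 (∀ {t} → t ∈ T → i ≤ t) → BoundedBelow G T
  boundedBelow a∈⋁T i∈⋁T a<i i≤T =
    _ , (a∈⋁T , λ ⋁T⊆a → <⇒≢ a<i (sym (⋁T⊆a _ i∈⋁T))) , λ _ t∈T → ℕ.<-≤-trans a<i (i≤T t∈T)

  nbb⇒NBB : ∀ {S} → nbb G S → NBB G S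
  nbb⇒NBB {S} nbbS T T⊆S (a , (a∈⋁T , _) , a<T) with Nonempty⇒∃-least T (∈⋁⇒Nonempty a∈⋁T)
  ... | m , m∈T , m≤T = ℕ.<⇒≱ (a<T m m∈T) m≤a
    where
    m≤a : m ≤ a
    m≤a = proj₂ (nbbS m (T⊆S m∈T)) a (lc-mono (λ _ y∈T → T⊆S y∈T , m≤T y∈T) a∈⋁T)

  NBB⇒nbb : ∀ {S} → NBB G S → nbb G S
  NBB⇒nbb {S} NBBS i i∈S = i∈lc , λ j j∈lc → ℕ.≮⇒≥ λ j<i →
    NBBS (S ≥ i) (proj₁ ∘ ∈S≥i)
      (boundedBelow (from∈⋁ j∈lc) (from∈⋁ i∈lc) j<i (proj₂ ∘ ∈S≥i))
    where
    i∈lc : _∈lc_ G i (λ j → j ∈ S × i ≤ j)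
    i∈lc = lc-extensive (i∈S , ≤-refl)
    ∈S≥i : ∀ {t} → t ∈ S ≥ i → t ∈ S × i ≤ t
    ∈S≥i = Equivalence.to ∈-≥
    from∈⋁ : ∀ {x} → _∈lc_ G x (λ j → j ∈ S × i ≤ j) → _∈⋁_ G x (S ≥ i)
    from∈⋁ = lc-mono (λ _ → Equivalence.from ∈-≥)

theorem2p28 : (n : ℕ) (G : Matroid n) → NoLoops G → NoMultiplePoints G →
    (S : Subset n) → nbb G S ⇔ NBB G S
theorem2p28 _ G _ _ _ = mk⇔ (nbb⇒NBB G) (NBB⇒nbb G)
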